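{- For all compositions $\alpha$ and $\beta$, \[\mathcal{H}(\alpha\circ\beta)=\mathcal{H}(\alpha)\big|_{x_i=\mathcal{H}(\beta^{\odot i})\ (i\ge1)}.\]
   Context: A composition is a finite sequence $\alpha=(a_1,\dots,a_k)$ of positive integers, with length $\ell(\alpha)=k$. For compositions of equal size, $\gamma\ge\alpha$ means every partial sum $g_1+\dots+g_j$ of $\gamma$ is a partial sum of $\alpha$. For $\alpha=(a_1,\dots,a_k)$ and $\beta=(b_1,\dots,b_m)$, concatenation is $\alpha\cdot\beta=(a_1,\dots,a_k,b_1,\dots,b_m)$ and near-concatenation is $\alpha\odot\beta=(a_1,\dots,a_{k-1},a_k+b_1,b_2,\dots,b_m)$. Write $\beta^{\odot i}=\beta\odot\cdots\odot\beta$ ($i$ copies), and define $\alpha\circ\beta=\beta^{\odot a_1}\cdot\beta^{\odot a_2}\cdots\beta^{\odot a_k}$. With indeterminates $y,z,x_1,x_2,\dots$, define \[\mathcal{H}(\alpha)=\sum_{\gamma\ge\alpha}\frac{y^{\ell(\gamma)-1}z^{\ell(\alpha)-\ell(\gamma)}}{(y+z)^{\ell(\alpha)-1}}\sum_{i=1}^{\ell(\gamma)}x_{\gamma_i}.\] This expression is linear in the $x_i$, and the substitution replaces each $x_i$ by $\mathcal{H}(\beta^{\odot i})$. -}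

module Defs where

open import Data.Nat as ℕ using (ℕ; zero; suc; _∸_)
open import Data.List using (List; []; _∷_; [_]; length; map; concatMap; foldr; filter)
open import Data.Nat.ListAction using (sum)
open import Data.List.Relation.Unary.All using (All; all?)
open import Data.List.Membership.DecPropositional ℕ._≟_ using (_∈_; _∈?_)
open import Data.Rational using (ℚ; 0ℚ; 1ℚ; _+_; _*_; 1/_; NonZero)
open import Relation.Nullary using (Dec)

-- A composition is represented by a List ℕ; positivity and non-emptiness
-- are imposed as hypotheses in the statement.

ℓ : List ℕ → ℕ
ℓ = length

psums′ : ℕ → List ℕ → List ℕ
psums′ acc []       = []
psums′ acc (a ∷ as) = (acc ℕ.+ a) ∷ psums′ (acc ℕ.+ a) as

psums : List ℕ → List ℕ
psums = psums′ 0

_≥c_ : List ℕ → List ℕ → Set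
γ ≥c α = All (_∈ psums α) (psums γ)

_≥c?_ : (γ α : List ℕ) → Dec (γ ≥c α)
γ ≥c? α = all? (_∈? psums α) (psums γ)

-- All compositions of n (each listed exactly once): a composition of n+1
-- arises from one of n by prepending a part 1 or incrementing the first part.
incHead : List ℕ → List ℕ
incHead []       = []
incHead (a ∷ as) = suc a ∷ as

comps : ℕ → List (List ℕ)
comps zero          = [ [] ]
comps (suc zero)    = [ 1 ∷ [] ]
comps (suc (suc n)) = concatMap (λ c → (1 ∷ c) ∷ incHead c ∷ []) (comps (suc n))

_⊙_ : List ℕ → List ℕ → List ℕ
[]               ⊙ β        = β
(a ∷ [])         ⊙ []       = a ∷ []
(a ∷ [])         ⊙ (b ∷ bs) = (a ℕ.+ b) ∷ bs
(a ∷ a′ ∷ as)    ⊙ β        = a ∷ ((a′ ∷ as) ⊙ β)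

_^⊙_ : List ℕ → ℕ → List ℕ
β ^⊙ zero  = []
β ^⊙ suc i = (β ^⊙ i) ⊙ β

_∘c_ : List ℕ → List ℕ → List ℕ
α ∘c β = concatMap (β ^⊙_) α

_^ℚ_ : ℚ → ℕ → ℚ
q ^ℚ zero  = 1ℚ
q ^ℚ suc n = q * (q ^ℚ n)

sumℚ : List ℚ → ℚ
sumℚ = foldr _+_ 0ℚ

-- 𝓗(α) evaluated at y, z ∈ ℚ (with y+z ≠ 0) and x_i = x i.
-- Since 𝓗(α) is linear in the x_i, the substitution x_i ↦ 𝓗(β^{⊙i})
-- is 𝓗 evaluated at the function i ↦ 𝓗(β^{⊙i}).
𝓗 : (y z : ℚ) → .{{_ : NonZero (y + z)}} → (ℕ → ℚ) → List ℕ → ℚ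
𝓗 y z x α =
  sumℚ (map term (filter (_≥c? α) (comps (sum α))))
  where
    term : List ℕ → ℚ
    term γ = (y ^ℚ (ℓ γ ∸ 1)) * (z ^ℚ (ℓ α ∸ ℓ γ)) * ((1/ (y + z)) ^ℚ (ℓ α ∸ 1))
             * sumℚ (map x γ)

{-# OPTIONS --safe #-}
module Submission where

-- Put p = y/(y+z). Then y^(ℓγ-1) z^(ℓα-ℓγ)/(y+z)^(ℓα-1) = p^(ℓγ-1) (1-p)^(ℓα-ℓγ), so 𝓗(α) is
-- the expected value of x_{γ₁} + ⋯ + x_{γ_ℓ(γ)} when each of the ℓ(α)-1 cuts of α is kept
-- independently with probability p and merged away otherwise. Conditioning on the first cut
-- (a coarsening of a·b·α either begins with the part a, followed by a coarsening of b·α, or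
-- is a coarsening of (a+b)·α) gives the recursion
--   𝓗(a) = x_a,   𝓗(a·b·α) = p (x_a + 𝓗(b·α)) + (1-p) 𝓗((a+b)·α),
-- and from it, with 𝓗 of the empty composition 0, the splitting rule
--   𝓗(u·v) = p (𝓗(u) + 𝓗(v)) + (1-p) 𝓗(u ⊙ v).
-- Since β^{⊙a} ⊙ β^{⊙b} = β^{⊙(a+b)}, the splitting rule turns 𝓗((a·b·α)∘β) into
-- p (𝓗(β^{⊙a}) + 𝓗((b·α)∘β)) + (1-p) 𝓗(((a+b)·α)∘β), which is the recursion for the
-- right-hand side; induction on α finishes the proof.

open import Defs
open import Data.Nat as ℕ using (ℕ; zero; suc; _<_; _≤_; _∸_; z≤n; s≤s)
import Data.Nat.Properties as ℕₚ
open import Data.Nat.ListAction using (sum)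
open import Data.List using (List; []; _∷_; [_]; length; map; concatMap; filter; _++_)
import Data.List.Properties as Listₚ
open import Data.List.Relation.Unary.All as All using (All; []; _∷_)
import Data.List.Relation.Unary.All.Properties as Allₚ
open import Data.List.Relation.Unary.Any using (here; there)
open import Data.List.Membership.Propositional using (_∈_)
open import Data.List.Membership.Propositional.Properties using (∈-map⁺; ∈-map⁻)
open import Data.Rational using (ℚ; _+_; _*_; _-_; 1/_; 0ℚ; 1ℚ; NonZero)
import Data.Rational.Properties as ℚₚ
open import Data.Rational.Solver using (module +-*-Solver)
open import Data.Product using (_×_; _,_)
open import Data.Bool using (true; false; if_then_else_)
open import Data.Empty using (⊥-elim)
open import Function using (_∘_; id)
open import Relation.Nullary using (¬_; Dec; yes; no; does)
open import Relation.Nullary.Decidable using (dec-true; dec-false)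
open import Relation.Unary using (Decidable)
open import Relation.Binary.Definitions using (tri<; tri≈; tri>)
open import Relation.Binary.PropositionalEquality using (_≡_; _≢_; refl; sym; trans; cong; cong₂; subst; subst₂; module ≡-Reasoning)

open +-*-Solver
open ≡-Reasoning

sumℚ-map-zero : ∀ {A : Set} {F : A → ℚ} xs → (∀ a → F a ≡ 0ℚ) → sumℚ (map F xs) ≡ 0ℚ
sumℚ-map-zero []       _   = refl
sumℚ-map-zero (a ∷ xs) F≡0 = trans (cong₂ _+_ (F≡0 a) (sumℚ-map-zero xs F≡0)) (ℚₚ.+-identityˡ 0ℚ)

sumℚ-map-*ˡ : ∀ {A : Set} k (F : A → ℚ) xs → sumℚ (map (λ a → k * F a) xs) ≡ k * sumℚ (map F xs)
sumℚ-map-*ˡ k F []       = sym (ℚₚ.*-zeroʳ k)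
sumℚ-map-*ˡ k F (a ∷ xs) =
  trans (cong (k * F a +_) (sumℚ-map-*ˡ k F xs)) (sym (ℚₚ.*-distribˡ-+ k (F a) _))

sumℚ-map-concatMap-pair : ∀ {A B : Set} (F : B → ℚ) (f g : A → B) xs →
  sumℚ (map F (concatMap (λ a → f a ∷ g a ∷ []) xs)) ≡ sumℚ (map (F ∘ f) xs) + sumℚ (map (F ∘ g) xs)
sumℚ-map-concatMap-pair F f g []       = sym (ℚₚ.+-identityˡ 0ℚ)
sumℚ-map-concatMap-pair F f g (a ∷ xs) =
  trans (cong (λ s → F (f a) + (F (g a) + s)) (sumℚ-map-concatMap-pair F f g xs))
        (solve 4 (λ u v s t → u :+ (v :+ (s :+ t)) := (u :+ s) :+ (v :+ t)) refl
               (F (f a)) (F (g a)) (sumℚ (map (F ∘ f) xs)) (sumℚ (map (F ∘ g) xs)))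

sumℚ-map-filter : ∀ {A : Set} {P : A → Set} (P? : Decidable P) (F : A → ℚ) xs →
  sumℚ (map F (filter P? xs)) ≡ sumℚ (map (λ a → if does (P? a) then F a else 0ℚ) xs)
sumℚ-map-filter P? F []       = refl
sumℚ-map-filter P? F (a ∷ xs) with does (P? a)
... | true  = cong (F a +_) (sumℚ-map-filter P? F xs)
... | false = trans (sumℚ-map-filter P? F xs) (sym (ℚₚ.+-identityˡ _))

if-does-scale : ∀ {P Q : Set} (P? : Dec P) (Q? : Dec Q) → (P → Q) → (Q → P) →
  ∀ k {u v} → (P → u ≡ k * v) → (if does P? then u else 0ℚ) ≡ k * (if does Q? then v else 0ℚ)
if-does-scale (yes P) (yes _) _   _   k u≡kv = u≡kv P
if-does-scale (yes P) (no ¬Q) P→Q _   _ _    = ⊥-elim (¬Q (P→Q P))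
if-does-scale (no ¬P) (yes Q) _   Q→P _ _    = ⊥-elim (¬P (Q→P Q))
if-does-scale (no _)  (no _)  _   _   k _    = sym (ℚₚ.*-zeroʳ k)

sumComps : ℕ → (List ℕ → ℚ) → ℚ
sumComps n F = sumℚ (map F (comps n))

sumComps-cong : ∀ n {F G : List ℕ → ℚ} → (∀ γ → F γ ≡ G γ) → sumComps n F ≡ sumComps n G
sumComps-cong n F≗G = cong sumℚ (Listₚ.map-cong F≗G (comps n))

comps-positive : ∀ n → All (λ γ → γ ≢ [] × All (0 <_) γ) (comps (suc n))
comps-positive zero    = ((λ ()) , ℕₚ.0<1+n ∷ []) ∷ []
comps-positive (suc n) = Allₚ.concat⁺ (Allₚ.map⁺ (All.map extend (comps-positive n)))
  where
  extend : ∀ {γ} → γ ≢ [] × All (0 <_) γ →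
           All (λ γ → γ ≢ [] × All (0 <_) γ) ((1 ∷ γ) ∷ incHead γ ∷ [])
  extend {[]}    (γ≢[] , _)         = ⊥-elim (γ≢[] refl)
  extend {g ∷ γ} (_ , g>0 ∷ γ>0) =
    ((λ ()) , ℕₚ.0<1+n ∷ g>0 ∷ γ>0) ∷ ((λ ()) , ℕₚ.0<1+n ∷ γ>0) ∷ []

sumComps-scale : ∀ n k {F G : List ℕ → ℚ} → (∀ {γ} → γ ≢ [] → All (0 <_) γ → F γ ≡ k * G γ) →
  sumComps (suc n) F ≡ k * sumComps (suc n) G
sumComps-scale n k {G = G} F≡kG =
  trans (cong sumℚ (Listₚ.map-cong-local (All.map (λ (γ≢[] , γ>0) → F≡kG γ≢[] γ>0) (comps-positive n))))
        (sumℚ-map-*ˡ k G (comps (suc n)))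

sumComps-incHead : ∀ n F → (∀ γ → F (1 ∷ γ) ≡ 0ℚ) →
  sumComps (suc (suc n)) F ≡ sumComps (suc n) (F ∘ incHead)
sumComps-incHead n F F≡0 = begin
    sumComps (suc (suc n)) F
  ≡⟨ sumℚ-map-concatMap-pair F (1 ∷_) incHead (comps (suc n)) ⟩
    sumComps (suc n) (λ γ → F (1 ∷ γ)) + sumComps (suc n) (F ∘ incHead)
  ≡⟨ cong (_+ sumComps (suc n) (F ∘ incHead)) (sumℚ-map-zero (comps (suc n)) F≡0) ⟩
    0ℚ + sumComps (suc n) (F ∘ incHead)
  ≡⟨ ℚₚ.+-identityˡ _ ⟩
    sumComps (suc n) (F ∘ incHead)
  ∎

sumComps-singleton : ∀ a F → (∀ g γ → g < suc a → F (g ∷ γ) ≡ 0ℚ) → sumComps (suc a) F ≡ F [ suc a ]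
sumComps-singleton zero    F _   = ℚₚ.+-identityʳ _
sumComps-singleton (suc a) F F≡0 =
  trans (sumComps-incHead a F (λ γ → F≡0 1 γ (s≤s ℕₚ.0<1+n)))
        (sumComps-singleton a (F ∘ incHead) (λ g γ g<a → F≡0 (suc g) γ (s≤s g<a)))

addToHead : ℕ → List ℕ → List ℕ
addToHead d []      = []
addToHead d (g ∷ γ) = (d ℕ.+ g) ∷ γ

incHead≡addToHead-1 : ∀ γ → incHead γ ≡ addToHead 1 γ
incHead≡addToHead-1 []      = refl
incHead≡addToHead-1 (_ ∷ _) = refl

addToHead-suc : ∀ d γ → addToHead (suc d) γ ≡ incHead (addToHead d γ)
addToHead-suc d []      = refl
addToHead-suc d (_ ∷ _) = refl

sumComps-splitFirstPart : ∀ a m F → (∀ g γ → g < suc a → F (g ∷ γ) ≡ 0ℚ) →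
  sumComps (suc (suc (a ℕ.+ m))) F
    ≡ sumComps (suc m) (λ γ → F (suc a ∷ γ)) + sumComps (suc m) (F ∘ addToHead (suc a))
sumComps-splitFirstPart zero    m F _   =
  trans (sumℚ-map-concatMap-pair F (1 ∷_) incHead (comps (suc m)))
        (cong (sumComps (suc m) (λ γ → F (1 ∷ γ)) +_)
              (sumComps-cong (suc m) (cong F ∘ incHead≡addToHead-1)))
sumComps-splitFirstPart (suc a) m F F≡0 = begin
    sumComps (suc (suc (suc a ℕ.+ m))) F
  ≡⟨ sumComps-incHead (suc (a ℕ.+ m)) F (λ γ → F≡0 1 γ (s≤s ℕₚ.0<1+n)) ⟩
    sumComps (suc (suc (a ℕ.+ m))) (F ∘ incHead)
  ≡⟨ sumComps-splitFirstPart a m (F ∘ incHead) (λ g γ g<a → F≡0 (suc g) γ (s≤s g<a)) ⟩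
    sumComps (suc m) (λ γ → F (suc (suc a) ∷ γ)) + sumComps (suc m) (F ∘ incHead ∘ addToHead (suc a))
  ≡⟨ cong (sumComps (suc m) (λ γ → F (suc (suc a) ∷ γ)) +_)
          (sumComps-cong (suc m) (cong F ∘ sym ∘ addToHead-suc (suc a))) ⟩
    sumComps (suc m) (λ γ → F (suc (suc a) ∷ γ)) + sumComps (suc m) (F ∘ addToHead (suc (suc a)))
  ∎

psums′-≥ : ∀ acc l → All (acc ≤_) (psums′ acc l)
psums′-≥ acc []      = []
psums′-≥ acc (a ∷ l) =
  ℕₚ.m≤m+n acc a ∷ All.map (ℕₚ.≤-trans (ℕₚ.m≤m+n acc a)) (psums′-≥ (acc ℕ.+ a) l)

psums′-> : ∀ acc {l} → All (0 <_) l → All (acc <_) (psums′ acc l)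
psums′-> acc {[]}    []        = []
psums′-> acc {a ∷ l} (a>0 ∷ _) = acc<acc+a ∷ All.map (ℕₚ.<-≤-trans acc<acc+a) (psums′-≥ (acc ℕ.+ a) l)
  where
  acc<acc+a : acc < acc ℕ.+ a
  acc<acc+a = ℕₚ.m<m+n acc a>0

psums′-+ : ∀ d acc l → psums′ (d ℕ.+ acc) l ≡ map (d ℕ.+_) (psums′ acc l)
psums′-+ d acc []      = refl
psums′-+ d acc (a ∷ l) =
  cong₂ _∷_ (ℕₚ.+-assoc d acc a)
            (trans (cong (λ t → psums′ t l) (ℕₚ.+-assoc d acc a)) (psums′-+ d (acc ℕ.+ a) l))

psums′≡map-psums : ∀ d l → psums′ d l ≡ map (d ℕ.+_) (psums l)
psums′≡map-psums d l = trans (cong (λ t → psums′ t l) (sym (ℕₚ.+-identityʳ d))) (psums′-+ d 0 l)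

All-∈-∷⁻ : ∀ {x : ℕ} {P Q} → All (x <_) Q → All (_∈ x ∷ P) Q → All (_∈ P) Q
All-∈-∷⁻ []          []               = []
All-∈-∷⁻ (x<x ∷ _)   (here refl ∷ _)   = ⊥-elim (ℕₚ.<-irrefl refl x<x)
All-∈-∷⁻ (_ ∷ x<Q)   (there q∈P ∷ Q⊆P) = q∈P ∷ All-∈-∷⁻ x<Q Q⊆P

∈-map-+⁻ : ∀ d {q P} → d ℕ.+ q ∈ map (d ℕ.+_) P → q ∈ P
∈-map-+⁻ d d+q∈ with q′ , q′∈P , eq ← ∈-map⁻ (d ℕ.+_) d+q∈ =
  subst (_∈ _) (sym (ℕₚ.+-cancelˡ-≡ d _ _ eq)) q′∈P

≥c-refl : ∀ α → α ≥c α
≥c-refl α = All.tabulate id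

≥c-[]⁻ : ∀ {γ} → γ ≥c [] → γ ≡ []
≥c-[]⁻ {[]}    _        = refl
≥c-[]⁻ {_ ∷ _} (() ∷ _)

≥c-head-< : ∀ {g a γ α} → g < a → ¬ (g ∷ γ) ≥c (a ∷ α)
≥c-head-<         g<a (here refl ∷ _) = ℕₚ.<-irrefl refl g<a
≥c-head-< {α = α} g<a (there g∈ ∷ _)  = ℕₚ.<⇒≱ g<a (All.lookup (psums′-≥ _ α) g∈)

≥c-∷⁺ : ∀ a {γ α} → γ ≥c α → (a ∷ γ) ≥c (a ∷ α)
≥c-∷⁺ a {γ} {α} γ≥α =
  here refl ∷ subst₂ (λ P Q → All (_∈ a ∷ P) Q)
                     (sym (psums′≡map-psums a α)) (sym (psums′≡map-psums a γ))
                     (Allₚ.map⁺ (All.map (λ q∈ → there (∈-map⁺ (a ℕ.+_) q∈)) γ≥α))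

≥c-∷⁻ : ∀ a {γ α} → All (0 <_) γ → (a ∷ γ) ≥c (a ∷ α) → γ ≥c α
≥c-∷⁻ a {γ} {α} γ>0 (_ ∷ aγ≥aα) =
  All.map (∈-map-+⁻ a)
    (Allₚ.map⁻ (subst₂ (λ P Q → All (_∈ P) Q) (psums′≡map-psums a α) (psums′≡map-psums a γ)
                        (All-∈-∷⁻ (psums′-> a γ>0) aγ≥aα)))

≥c-merge⁺ : ∀ {γ} a b α → γ ≥c ((a ℕ.+ b) ∷ α) → γ ≥c (a ∷ b ∷ α)
≥c-merge⁺ _ _ _ = All.map there

≥c-merge⁻ : ∀ {g γ a b α} → a < g → (g ∷ γ) ≥c (a ∷ b ∷ α) → (g ∷ γ) ≥c ((a ℕ.+ b) ∷ α)
≥c-merge⁻ {g} {γ} a<g = All-∈-∷⁻ (a<g ∷ All.map (ℕₚ.<-≤-trans a<g) (psums′-≥ g γ))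

≥c-length : ∀ a α {γ} → All (0 <_) γ → γ ≥c (a ∷ α) → length γ ≤ length (a ∷ α)
≥c-length a α       {[]}    _ _ = z≤n
≥c-length a []      {g ∷ γ} (_ ∷ γ>0) gγ≥a@(here refl ∷ _) =
  s≤s (ℕₚ.≤-reflexive (cong length (≥c-[]⁻ (≥c-∷⁻ a γ>0 gγ≥a))))
≥c-length a []      {g ∷ γ} _ (there () ∷ _)
≥c-length a (b ∷ α) {g ∷ γ} (g>0 ∷ γ>0) gγ≥ with ℕₚ.<-cmp g a
... | tri< g<a _ _  = ⊥-elim (≥c-head-< g<a gγ≥)
... | tri≈ _ refl _ = s≤s (≥c-length b α γ>0 (≥c-∷⁻ a γ>0 gγ≥))
... | tri> _ _ a<g  = ℕₚ.m≤n⇒m≤1+n (≥c-length (a ℕ.+ b) α (g>0 ∷ γ>0) (≥c-merge⁻ a<g gγ≥))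

⊙-identityʳ : ∀ α → α ⊙ [] ≡ α
⊙-identityʳ []          = refl
⊙-identityʳ (a ∷ [])    = refl
⊙-identityʳ (a ∷ b ∷ α) = cong (a ∷_) (⊙-identityʳ (b ∷ α))

⊙-≢[]ˡ : ∀ a α β → (a ∷ α) ⊙ β ≢ []
⊙-≢[]ˡ a []      []      ()
⊙-≢[]ˡ a []      (_ ∷ _) ()
⊙-≢[]ˡ a (_ ∷ _) _       ()

⊙-≢[]ʳ : ∀ α {β} → β ≢ [] → α ⊙ β ≢ []
⊙-≢[]ʳ []      β≢[] = β≢[]
⊙-≢[]ʳ (a ∷ α) _    = ⊙-≢[]ˡ a α _

∷-⊙ : ∀ a {α} β → α ≢ [] → (a ∷ α) ⊙ β ≡ a ∷ (α ⊙ β)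
∷-⊙ a {[]}    β α≢[] = ⊥-elim (α≢[] refl)
∷-⊙ a {_ ∷ _} β _    = refl

[a]⊙ : ∀ a {β} → β ≢ [] → [ a ] ⊙ β ≡ addToHead a β
[a]⊙ a {[]}    β≢[] = ⊥-elim (β≢[] refl)
[a]⊙ a {_ ∷ _} _    = refl

addToHead-⊙ : ∀ a c α β → addToHead a (c ∷ α) ⊙ β ≡ addToHead a ((c ∷ α) ⊙ β)
addToHead-⊙ a c []      []      = refl
addToHead-⊙ a c []      (b ∷ β) = cong (_∷ β) (ℕₚ.+-assoc a c b)
addToHead-⊙ a c (_ ∷ _) β       = refl

⊙-assoc : ∀ α β γ → α ⊙ (β ⊙ γ) ≡ (α ⊙ β) ⊙ γ
⊙-assoc []           β       γ = refl
⊙-assoc (a ∷ [])     []      γ = refl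
⊙-assoc (a ∷ [])     (b ∷ β) γ = trans ([a]⊙ a (⊙-≢[]ˡ b β γ)) (sym (addToHead-⊙ a b β γ))
⊙-assoc (a ∷ a′ ∷ α) β       γ =
  trans (cong (a ∷_) (⊙-assoc (a′ ∷ α) β γ)) (sym (∷-⊙ a γ (⊙-≢[]ˡ a′ α β)))

⊙-++ : ∀ α {β} γ → β ≢ [] → α ⊙ (β ++ γ) ≡ (α ⊙ β) ++ γ
⊙-++ []                     γ _    = refl
⊙-++ (a ∷ [])     {[]}      γ β≢[] = ⊥-elim (β≢[] refl)
⊙-++ (a ∷ [])     {_ ∷ _}   γ _    = refl
⊙-++ (a ∷ a′ ∷ α)           γ β≢[] = cong (a ∷_) (⊙-++ (a′ ∷ α) γ β≢[])

^⊙-+ : ∀ β i j → (β ^⊙ i) ⊙ (β ^⊙ j) ≡ β ^⊙ (i ℕ.+ j)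
^⊙-+ β i zero    = trans (⊙-identityʳ _) (cong (β ^⊙_) (sym (ℕₚ.+-identityʳ i)))
^⊙-+ β i (suc j) = begin
    (β ^⊙ i) ⊙ ((β ^⊙ j) ⊙ β)  ≡⟨ ⊙-assoc (β ^⊙ i) (β ^⊙ j) β ⟩
    ((β ^⊙ i) ⊙ (β ^⊙ j)) ⊙ β  ≡⟨ cong (_⊙ β) (^⊙-+ β i j) ⟩
    (β ^⊙ (i ℕ.+ j)) ⊙ β       ≡⟨ cong (β ^⊙_) (sym (ℕₚ.+-suc i j)) ⟩
    β ^⊙ (i ℕ.+ suc j)         ∎

^⊙-≢[] : ∀ {β} → β ≢ [] → ∀ {i} → 0 < i → β ^⊙ i ≢ []
^⊙-≢[] β≢[] {suc i} _ = ⊙-≢[]ʳ (_ ^⊙ i) β≢[]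

⊙-positive : ∀ {α β} → All (0 <_) α → All (0 <_) β → All (0 <_) (α ⊙ β)
⊙-positive {[]}               _           β>0       = β>0
⊙-positive {a ∷ []}  {[]}     α>0         _         = α>0
⊙-positive {a ∷ []}  {b ∷ β}  (a>0 ∷ [])  (_ ∷ β>0) = ℕₚ.<-≤-trans a>0 (ℕₚ.m≤m+n a b) ∷ β>0
⊙-positive {_ ∷ _ ∷ _}        (a>0 ∷ α>0) β>0       = a>0 ∷ ⊙-positive α>0 β>0

^⊙-positive : ∀ {β} → All (0 <_) β → ∀ i → All (0 <_) (β ^⊙ i)
^⊙-positive β>0 zero    = []
^⊙-positive β>0 (suc i) = ⊙-positive (^⊙-positive β>0 i) β>0

∘c-positive : ∀ {β} → All (0 <_) β → ∀ α → All (0 <_) (α ∘c β)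
∘c-positive β>0 []      = []
∘c-positive β>0 (a ∷ α) = Allₚ.++⁺ (^⊙-positive β>0 a) (∘c-positive β>0 α)

module _ (p : ℚ) where

  -- 𝓗ʳ′ x a α is 𝓗ʳ x (a ∷ α); keeping the first part apart makes the merged composition
  -- (a + b) ∷ α a structurally smaller call.
  𝓗ʳ′ : (ℕ → ℚ) → ℕ → List ℕ → ℚ
  𝓗ʳ′ x a []      = x a
  𝓗ʳ′ x a (b ∷ α) = p * (x a + 𝓗ʳ′ x b α) + (1ℚ - p) * 𝓗ʳ′ x (a ℕ.+ b) α

  𝓗ʳ : (ℕ → ℚ) → List ℕ → ℚ
  𝓗ʳ x []      = 0ℚ
  𝓗ʳ x (a ∷ α) = 𝓗ʳ′ x a α

  𝓗ʳ′-cong : ∀ {x x′ : ℕ → ℚ} → (∀ i → x i ≡ x′ i) → ∀ a α → 𝓗ʳ′ x a α ≡ 𝓗ʳ′ x′ a α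
  𝓗ʳ′-cong x≗x′ a []      = x≗x′ a
  𝓗ʳ′-cong x≗x′ a (b ∷ α) =
    cong₂ (λ s t → p * s + (1ℚ - p) * t)
          (cong₂ _+_ (x≗x′ a) (𝓗ʳ′-cong x≗x′ b α)) (𝓗ʳ′-cong x≗x′ (a ℕ.+ b) α)

  𝓗ʳ-cong : ∀ {x x′ : ℕ → ℚ} → (∀ i → x i ≡ x′ i) → ∀ α → 𝓗ʳ x α ≡ 𝓗ʳ x′ α
  𝓗ʳ-cong x≗x′ []      = refl
  𝓗ʳ-cong x≗x′ (a ∷ α) = 𝓗ʳ′-cong x≗x′ a α

  𝓗ʳ-∷ : ∀ x a {γ} → γ ≢ [] → 𝓗ʳ x (a ∷ γ) ≡ p * (x a + 𝓗ʳ x γ) + (1ℚ - p) * 𝓗ʳ x (addToHead a γ)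
  𝓗ʳ-∷ x a {[]}    γ≢[] = ⊥-elim (γ≢[] refl)
  𝓗ʳ-∷ x a {_ ∷ _} _    = refl

  𝓗ʳ′-++-∷ : ∀ x a α b β →
    𝓗ʳ′ x a (α ++ b ∷ β) ≡ p * (𝓗ʳ′ x a α + 𝓗ʳ′ x b β) + (1ℚ - p) * 𝓗ʳ x ((a ∷ α) ⊙ (b ∷ β))
  𝓗ʳ′-++-∷ x a []      b β = refl
  𝓗ʳ′-++-∷ x a (c ∷ α) b β = begin
      p * (x a + 𝓗ʳ′ x c (α ++ b ∷ β)) + q * 𝓗ʳ′ x (a ℕ.+ c) (α ++ b ∷ β)
    ≡⟨ cong₂ (λ s t → p * (x a + s) + q * t) (𝓗ʳ′-++-∷ x c α b β) (𝓗ʳ′-++-∷ x (a ℕ.+ c) α b β) ⟩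
      p * (x a + (p * (A + B) + q * 𝓗ʳ x L)) + q * (p * (D + B) + q * 𝓗ʳ x ((a ℕ.+ c ∷ α) ⊙ (b ∷ β)))
    ≡⟨ cong (λ t → p * (x a + (p * (A + B) + q * 𝓗ʳ x L)) + q * (p * (D + B) + q * 𝓗ʳ x t))
            (addToHead-⊙ a c α (b ∷ β)) ⟩
      p * (x a + (p * (A + B) + q * 𝓗ʳ x L)) + q * (p * (D + B) + q * 𝓗ʳ x (addToHead a L))
    ≡⟨ solve 7 (λ p X A B C D E →
         p :* (X :+ (p :* (A :+ B) :+ (con 1ℚ :- p) :* C))
           :+ (con 1ℚ :- p) :* (p :* (D :+ B) :+ (con 1ℚ :- p) :* E)
         := p :* ((p :* (X :+ A) :+ (con 1ℚ :- p) :* D) :+ B)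
           :+ (con 1ℚ :- p) :* (p :* (X :+ C) :+ (con 1ℚ :- p) :* E))
         refl p (x a) A B (𝓗ʳ x L) D (𝓗ʳ x (addToHead a L)) ⟩
      p * (𝓗ʳ′ x a (c ∷ α) + B) + q * (p * (x a + 𝓗ʳ x L) + q * 𝓗ʳ x (addToHead a L))
    ≡⟨ cong (λ t → p * (𝓗ʳ′ x a (c ∷ α) + B) + q * t) (sym (𝓗ʳ-∷ x a (⊙-≢[]ˡ c α (b ∷ β)))) ⟩
      p * (𝓗ʳ′ x a (c ∷ α) + B) + q * 𝓗ʳ x (a ∷ L)
    ∎
    where
    q A B D : ℚ
    q = 1ℚ - p
    A = 𝓗ʳ′ x c α
    B = 𝓗ʳ′ x b β
    D = 𝓗ʳ′ x (a ℕ.+ c) α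
    L : List ℕ
    L = (c ∷ α) ⊙ (b ∷ β)

  𝓗ʳ-++ : ∀ x α β → 𝓗ʳ x (α ++ β) ≡ p * (𝓗ʳ x α + 𝓗ʳ x β) + (1ℚ - p) * 𝓗ʳ x (α ⊙ β)
  𝓗ʳ-++ x []      β       =
    solve 2 (λ p H → H := p :* (con 0ℚ :+ H) :+ (con 1ℚ :- p) :* H) refl p (𝓗ʳ x β)
  𝓗ʳ-++ x (a ∷ α) []      = begin
      𝓗ʳ x ((a ∷ α) ++ [])
    ≡⟨ cong (𝓗ʳ x) (Listₚ.++-identityʳ (a ∷ α)) ⟩
      𝓗ʳ x (a ∷ α)
    ≡⟨ solve 2 (λ p H → H := p :* (H :+ con 0ℚ) :+ (con 1ℚ :- p) :* H) refl p (𝓗ʳ x (a ∷ α)) ⟩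
      p * (𝓗ʳ x (a ∷ α) + 0ℚ) + (1ℚ - p) * 𝓗ʳ x (a ∷ α)
    ≡⟨ cong (λ t → p * (𝓗ʳ x (a ∷ α) + 0ℚ) + (1ℚ - p) * 𝓗ʳ x t) (sym (⊙-identityʳ (a ∷ α))) ⟩
      p * (𝓗ʳ x (a ∷ α) + 0ℚ) + (1ℚ - p) * 𝓗ʳ x ((a ∷ α) ⊙ [])
    ∎
  𝓗ʳ-++ x (a ∷ α) (b ∷ β) = 𝓗ʳ′-++-∷ x a α b β

  𝓗ʳ′-∘c : ∀ x {β} → β ≢ [] → ∀ a α → All (0 <_) α →
    𝓗ʳ x ((a ∷ α) ∘c β) ≡ 𝓗ʳ′ (λ i → 𝓗ʳ x (β ^⊙ i)) a α
  𝓗ʳ′-∘c x {β} _    a []      []          = cong (𝓗ʳ x) (Listₚ.++-identityʳ (β ^⊙ a))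
  𝓗ʳ′-∘c x {β} β≢[] a (b ∷ α) (b>0 ∷ α>0) = begin
      𝓗ʳ x (β ^⊙ a ++ (β ^⊙ b ++ R))
    ≡⟨ 𝓗ʳ-++ x (β ^⊙ a) (β ^⊙ b ++ R) ⟩
      p * (𝓗ʳ x (β ^⊙ a) + 𝓗ʳ x (β ^⊙ b ++ R)) + (1ℚ - p) * 𝓗ʳ x ((β ^⊙ a) ⊙ (β ^⊙ b ++ R))
    ≡⟨ cong (λ t → p * (𝓗ʳ x (β ^⊙ a) + 𝓗ʳ x (β ^⊙ b ++ R)) + (1ℚ - p) * 𝓗ʳ x t)
            (trans (⊙-++ (β ^⊙ a) R (^⊙-≢[] β≢[] b>0)) (cong (_++ R) (^⊙-+ β a b))) ⟩
      p * (𝓗ʳ x (β ^⊙ a) + 𝓗ʳ x (β ^⊙ b ++ R)) + (1ℚ - p) * 𝓗ʳ x (β ^⊙ (a ℕ.+ b) ++ R)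
    ≡⟨ cong₂ (λ s t → p * (𝓗ʳ x (β ^⊙ a) + s) + (1ℚ - p) * t)
             (𝓗ʳ′-∘c x β≢[] b α α>0) (𝓗ʳ′-∘c x β≢[] (a ℕ.+ b) α α>0) ⟩
      𝓗ʳ′ (λ i → 𝓗ʳ x (β ^⊙ i)) a (b ∷ α)
    ∎
    where
    R : List ℕ
    R = α ∘c β

  𝓗ʳ-∘c : ∀ x {β} → β ≢ [] → ∀ {α} → All (0 <_) α → 𝓗ʳ x (α ∘c β) ≡ 𝓗ʳ (λ i → 𝓗ʳ x (β ^⊙ i)) α
  𝓗ʳ-∘c x β≢[] {[]}    _         = refl
  𝓗ʳ-∘c x β≢[] {a ∷ α} (_ ∷ α>0) = 𝓗ʳ′-∘c x β≢[] a α α>0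

module WeightedCoarsening (y z : ℚ) .{{_ : NonZero (y + z)}} where

  p : ℚ
  p = y * 1/ (y + z)

  z*1/[y+z]≡1-p : z * 1/ (y + z) ≡ 1ℚ - p
  z*1/[y+z]≡1-p = begin
      z * c            ≡⟨ solve 3 (λ y z c → z :* c := (y :+ z) :* c :- y :* c) refl y z c ⟩
      (y + z) * c - p  ≡⟨ cong (_- p) (ℚₚ.*-inverseʳ (y + z)) ⟩
      1ℚ - p           ∎
    where
    c : ℚ
    c = 1/ (y + z)

  weight : List ℕ → List ℕ → ℚ
  weight α γ = (y ^ℚ (ℓ γ ∸ 1)) * (z ^ℚ (ℓ α ∸ ℓ γ)) * ((1/ (y + z)) ^ℚ (ℓ α ∸ 1))

  term : List ℕ → (List ℕ → ℚ) → List ℕ → ℚ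
  term α h γ = if does (γ ≥c? α) then weight α γ * h γ else 0ℚ

  coarseningSum : List ℕ → (List ℕ → ℚ) → ℚ
  coarseningSum α h = sumComps (sum α) (term α h)

  𝓗≡coarseningSum : ∀ x α → 𝓗 y z x α ≡ coarseningSum α (λ γ → sumℚ (map x γ))
  𝓗≡coarseningSum x α = sumℚ-map-filter (_≥c? α) _ (comps (sum α))

  coarseningSum-cong : ∀ α {h h′ : List ℕ → ℚ} → (∀ γ → h γ ≡ h′ γ) →
    coarseningSum α h ≡ coarseningSum α h′
  coarseningSum-cong α h≗h′ =
    sumComps-cong (sum α) (λ γ → cong (λ v → if does (γ ≥c? α) then weight α γ * v else 0ℚ) (h≗h′ γ))

  weight-keep : ∀ a b α g γ → weight (a ∷ b ∷ α) (a ∷ g ∷ γ) ≡ p * weight (b ∷ α) (g ∷ γ)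
  weight-keep a b α g γ =
    solve 5 (λ y Y Z c C → y :* Y :* Z :* (c :* C) := (y :* c) :* (Y :* Z :* C)) refl
          y (y ^ℚ ℓ γ) (z ^ℚ (ℓ α ∸ ℓ γ)) (1/ (y + z)) ((1/ (y + z)) ^ℚ ℓ α)

  weight-merge : ∀ a b α γ → ℓ γ ≤ ℓ ((a ℕ.+ b) ∷ α) →
    weight (a ∷ b ∷ α) γ ≡ (1ℚ - p) * weight ((a ℕ.+ b) ∷ α) γ
  weight-merge a b α γ ℓγ≤ = begin
      Y * z ^ℚ (2 ℕ.+ ℓ α ∸ ℓ γ) * c ^ℚ suc (ℓ α)
    ≡⟨ cong (λ e → Y * z ^ℚ e * c ^ℚ suc (ℓ α)) (ℕₚ.+-∸-assoc 1 ℓγ≤) ⟩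
      Y * (z * z ^ℚ (suc (ℓ α) ∸ ℓ γ)) * (c * c ^ℚ ℓ α)
    ≡⟨ solve 5 (λ Y z Z c C → Y :* (z :* Z) :* (c :* C) := (z :* c) :* (Y :* Z :* C)) refl
             Y z (z ^ℚ (suc (ℓ α) ∸ ℓ γ)) c (c ^ℚ ℓ α) ⟩
      (z * c) * weight ((a ℕ.+ b) ∷ α) γ
    ≡⟨ cong (_* weight ((a ℕ.+ b) ∷ α) γ) z*1/[y+z]≡1-p ⟩
      (1ℚ - p) * weight ((a ℕ.+ b) ∷ α) γ
    ∎
    where
    c Y : ℚ
    c = 1/ (y + z)
    Y = y ^ℚ (ℓ γ ∸ 1)

  term-head-< : ∀ a α h g γ → g < a → term (a ∷ α) h (g ∷ γ) ≡ 0ℚ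
  term-head-< a α h g γ g<a =
    cong (if_then weight (a ∷ α) (g ∷ γ) * h (g ∷ γ) else 0ℚ)
         (dec-false ((g ∷ γ) ≥c? (a ∷ α)) (≥c-head-< g<a))

  term-singleton : ∀ a h → term [ a ] h [ a ] ≡ h [ a ]
  term-singleton a h =
    trans (cong (if_then weight [ a ] [ a ] * h [ a ] else 0ℚ)
                (dec-true ([ a ] ≥c? [ a ]) (≥c-refl [ a ])))
          (ℚₚ.*-identityˡ (h [ a ]))

  term-keep : ∀ a b α h {γ} → γ ≢ [] → All (0 <_) γ →
    term (a ∷ b ∷ α) h (a ∷ γ) ≡ p * term (b ∷ α) (h ∘ (a ∷_)) γ
  term-keep a b α h {[]}    γ≢[] _    = ⊥-elim (γ≢[] refl)
  term-keep a b α h {g ∷ γ} _    gγ>0 =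
    if-does-scale ((a ∷ g ∷ γ) ≥c? (a ∷ b ∷ α)) ((g ∷ γ) ≥c? (b ∷ α)) (≥c-∷⁻ a gγ>0) (≥c-∷⁺ a) p
      (λ _ → trans (cong (_* h (a ∷ g ∷ γ)) (weight-keep a b α g γ)) (ℚₚ.*-assoc p _ _))

  term-merge : ∀ a b α h {γ} → γ ≢ [] → All (0 <_) γ →
    term (a ∷ b ∷ α) h (addToHead a γ) ≡ (1ℚ - p) * term ((a ℕ.+ b) ∷ α) h (addToHead a γ)
  term-merge a b α h {[]}    γ≢[] _           = ⊥-elim (γ≢[] refl)
  term-merge a b α h {g ∷ γ} _    (g>0 ∷ γ>0) =
    if-does-scale (a+gγ ≥c? (a ∷ b ∷ α)) (a+gγ ≥c? ((a ℕ.+ b) ∷ α))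
      (≥c-merge⁻ a<a+g) (≥c-merge⁺ a b α) (1ℚ - p)
      (λ a+gγ≥ → trans (cong (_* h a+gγ) (weight-merge a b α a+gγ (ℓ≤ a+gγ≥)))
                       (ℚₚ.*-assoc (1ℚ - p) _ _))
    where
    a+gγ : List ℕ
    a+gγ = (a ℕ.+ g) ∷ γ
    a<a+g : a < a ℕ.+ g
    a<a+g = ℕₚ.m<m+n a g>0
    ℓ≤ : a+gγ ≥c (a ∷ b ∷ α) → ℓ a+gγ ≤ ℓ ((a ℕ.+ b) ∷ α)
    ℓ≤ = ≥c-length (a ℕ.+ b) α (ℕₚ.<-≤-trans g>0 (ℕₚ.m≤n+m g a) ∷ γ>0) ∘ ≥c-merge⁻ a<a+g

  coarseningSum-singleton : ∀ a h → 0 < a → coarseningSum [ a ] h ≡ h [ a ]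
  coarseningSum-singleton (suc a) h _ = begin
      sumComps (suc a ℕ.+ 0) (term [ suc a ] h)
    ≡⟨ cong (λ n → sumComps n (term [ suc a ] h)) (ℕₚ.+-identityʳ (suc a)) ⟩
      sumComps (suc a) (term [ suc a ] h)
    ≡⟨ sumComps-singleton a _ (term-head-< (suc a) [] h) ⟩
      term [ suc a ] h [ suc a ]
    ≡⟨ term-singleton (suc a) h ⟩
      h [ suc a ]
    ∎

  coarseningSum-∷∷ : ∀ a b α h → 0 < a → 0 < b →
    coarseningSum (a ∷ b ∷ α) h
      ≡ p * coarseningSum (b ∷ α) (h ∘ (a ∷_)) + (1ℚ - p) * coarseningSum ((a ℕ.+ b) ∷ α) h
  coarseningSum-∷∷ a@(suc a′) b@(suc b′) α h _ b>0 = begin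
      coarseningSum (a ∷ b ∷ α) h
    ≡⟨ split (a ∷ b ∷ α) (cong suc (ℕₚ.+-suc a′ m)) (term-head-< a (b ∷ α) h) ⟩
      sumComps (suc m) (λ γ → term (a ∷ b ∷ α) h (a ∷ γ))
        + sumComps (suc m) (term (a ∷ b ∷ α) h ∘ addToHead a)
    ≡⟨ cong₂ _+_ (sumComps-scale m p (term-keep a b α h))
                 (sumComps-scale m (1ℚ - p) (term-merge a b α h)) ⟩
      p * coarseningSum (b ∷ α) (h ∘ (a ∷_)) + (1ℚ - p) * sumComps (suc m) (term α₊ h ∘ addToHead a)
    ≡⟨ cong (λ s → p * coarseningSum (b ∷ α) (h ∘ (a ∷_)) + (1ℚ - p) * s) (sym merged) ⟩
      p * coarseningSum (b ∷ α) (h ∘ (a ∷_)) + (1ℚ - p) * coarseningSum α₊ h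
    ∎
    where
    m : ℕ
    m = b′ ℕ.+ sum α
    α₊ : List ℕ
    α₊ = (a ℕ.+ b) ∷ α
    split : ∀ α′ → sum α′ ≡ suc (suc (a′ ℕ.+ m)) → (∀ g γ → g < a → term α′ h (g ∷ γ) ≡ 0ℚ) →
      coarseningSum α′ h
        ≡ sumComps (suc m) (λ γ → term α′ h (a ∷ γ)) + sumComps (suc m) (term α′ h ∘ addToHead a)
    split α′ Σα′≡ F≡0 =
      trans (cong (λ n → sumComps n (term α′ h)) Σα′≡) (sumComps-splitFirstPart a′ m _ F≡0)
    merged : coarseningSum α₊ h ≡ sumComps (suc m) (term α₊ h ∘ addToHead a)
    merged = begin
        coarseningSum α₊ h
      ≡⟨ split α₊ (cong suc (trans (ℕₚ.+-assoc a′ b (sum α)) (ℕₚ.+-suc a′ m)))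
               (λ g γ g<a → term-head-< (a ℕ.+ b) α h g γ (ℕₚ.<-≤-trans g<a (ℕₚ.m≤m+n a b))) ⟩
        sumComps (suc m) (λ γ → term α₊ h (a ∷ γ)) + sumComps (suc m) (term α₊ h ∘ addToHead a)
      ≡⟨ cong (_+ sumComps (suc m) (term α₊ h ∘ addToHead a))
              (sumℚ-map-zero (comps (suc m)) (λ γ → term-head-< (a ℕ.+ b) α h a γ (ℕₚ.m<m+n a b>0))) ⟩
        0ℚ + sumComps (suc m) (term α₊ h ∘ addToHead a)
      ≡⟨ ℚₚ.+-identityˡ _ ⟩
        sumComps (suc m) (term α₊ h ∘ addToHead a)
      ∎

  -- The constant k is needed for the induction: in the branch that keeps the first cut,
  -- x a joins the constant.
  coarseningSum-affine : ∀ x k a α → 0 < a → All (0 <_) α →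
    coarseningSum (a ∷ α) (λ γ → k + sumℚ (map x γ)) ≡ k + 𝓗ʳ′ p x a α
  coarseningSum-affine x k a []      a>0 [] =
    trans (coarseningSum-singleton a _ a>0) (cong (k +_) (ℚₚ.+-identityʳ (x a)))
  coarseningSum-affine x k a (b ∷ α) a>0 (b>0 ∷ α>0) = begin
      coarseningSum (a ∷ b ∷ α) (λ γ → k + sumℚ (map x γ))
    ≡⟨ coarseningSum-∷∷ a b α _ a>0 b>0 ⟩
      p * coarseningSum (b ∷ α) (λ γ → k + (x a + sumℚ (map x γ)))
        + (1ℚ - p) * coarseningSum ((a ℕ.+ b) ∷ α) (λ γ → k + sumℚ (map x γ))
    ≡⟨ cong₂ (λ s t → p * s + (1ℚ - p) * t)
             (trans (coarseningSum-cong (b ∷ α) (λ γ → sym (ℚₚ.+-assoc k (x a) _)))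
                    (coarseningSum-affine x (k + x a) b α b>0 α>0))
             (coarseningSum-affine x k (a ℕ.+ b) α (ℕₚ.<-≤-trans a>0 (ℕₚ.m≤m+n a b)) α>0) ⟩
      p * ((k + x a) + 𝓗ʳ′ p x b α) + (1ℚ - p) * (k + 𝓗ʳ′ p x (a ℕ.+ b) α)
    ≡⟨ solve 5 (λ p k X B D → p :* ((k :+ X) :+ B) :+ (con 1ℚ :- p) :* (k :+ D)
                              := k :+ (p :* (X :+ B) :+ (con 1ℚ :- p) :* D))
             refl p k (x a) (𝓗ʳ′ p x b α) (𝓗ʳ′ p x (a ℕ.+ b) α) ⟩
      k + 𝓗ʳ′ p x a (b ∷ α)
    ∎

  𝓗≡𝓗ʳ : ∀ x {α} → All (0 <_) α → 𝓗 y z x α ≡ 𝓗ʳ p x α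
  𝓗≡𝓗ʳ x {[]}    []          = refl
  𝓗≡𝓗ʳ x {a ∷ α} (a>0 ∷ α>0) = begin
      𝓗 y z x (a ∷ α)
    ≡⟨ 𝓗≡coarseningSum x (a ∷ α) ⟩
      coarseningSum (a ∷ α) (λ γ → sumℚ (map x γ))
    ≡⟨ coarseningSum-cong (a ∷ α) (λ _ → sym (ℚₚ.+-identityˡ _)) ⟩
      coarseningSum (a ∷ α) (λ γ → 0ℚ + sumℚ (map x γ))
    ≡⟨ coarseningSum-affine x 0ℚ a α a>0 α>0 ⟩
      0ℚ + 𝓗ʳ′ p x a α
    ≡⟨ ℚₚ.+-identityˡ _ ⟩
      𝓗ʳ′ p x a α
    ∎

proposition6p3 : (α β : List ℕ) → α ≢ [] → All (0 <_) α → β ≢ [] → All (0 <_) β →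
    (y z : ℚ) → .{{_ : NonZero (y + z)}} → (x : ℕ → ℚ) →
    𝓗 y z x (α ∘c β) ≡ 𝓗 y z (λ i → 𝓗 y z x (β ^⊙ i)) α
proposition6p3 α β _ α>0 β≢[] β>0 y z x = begin
    𝓗 y z x (α ∘c β)                   ≡⟨ 𝓗≡𝓗ʳ x (∘c-positive β>0 α) ⟩
    𝓗ʳ p x (α ∘c β)                    ≡⟨ 𝓗ʳ-∘c p x β≢[] α>0 ⟩
    𝓗ʳ p (λ i → 𝓗ʳ p x (β ^⊙ i)) α     ≡⟨ 𝓗ʳ-cong p (λ i → sym (𝓗≡𝓗ʳ x (^⊙-positive β>0 i))) α ⟩
    𝓗ʳ p (λ i → 𝓗 y z x (β ^⊙ i)) α    ≡⟨ sym (𝓗≡𝓗ʳ _ α>0) ⟩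
    𝓗 y z (λ i → 𝓗 y z x (β ^⊙ i)) α   ∎
  where open WeightedCoarsening y z
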